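{- For every $\theta\in\mathbb{F}_q((1/t))$ one has $c(\theta):=\sup_{\gamma\in\mathbb{F}_q((1/t))}c(\theta,\gamma)\geq q^{ -2}$.
   Context: $q$ is a prime power, $\mathbb{F}_q[t]$ the polynomial ring over $\mathbb{F}_q$, and $\mathbb{F}_q((1/t))$ the field of Laurent series $\theta=\sum_i\theta_it^{ -i}$ with finitely many nonzero coefficients of positive powers of $t$. Absolute value: $|\theta|=q^{\deg\theta}$, $|0|=0$. Fractional part: $\langle\theta\rangle=\sum_{i\ge1}\theta_it^{ -i}$. $c(\theta,\gamma)=\inf_{0\ne N\in\mathbb{F}_q[t]}|N|\cdot|\langle N\theta-\gamma\rangle|$. -}

module Defs where

open import Level using (0ℓ)
open import Data.Nat as ℕ using (ℕ; zero; suc)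
open import Data.Integer as ℤ using (ℤ; +_; _≤_; _<_)
open import Data.Fin as Fin using (Fin; toℕ; fromℕ)
open import Data.Product using (Σ; ∃; _×_; _,_)
open import Relation.Nullary using (¬_)
open import Relation.Binary.PropositionalEquality using (_≡_)
open import Algebra.Bundles using (CommutativeRing)

-- A finite field with q elements (q is then automatically a prime power).
record FiniteField : Set₁ where
  field
    commRing : CommutativeRing 0ℓ 0ℓ
  open CommutativeRing commRing public
  field
    0≉1     : ¬ (0# ≈ 1#)
    inverse : ∀ x → ¬ (x ≈ 0#) → ∃ λ y → (x * y) ≈ 1#
    q       : ℕ
    enum    : Fin q → Carrier
    enum-surjective : ∀ x → ∃ λ i → enum i ≈ x
    enum-injective  : ∀ i j → enum i ≈ enum j → i ≡ j

module _ (F : FiniteField) where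
  open FiniteField F using (Carrier; _≈_; _+_; _*_; 0#; commRing)

  -- A Laurent series θ = Σ_j θ_j t^j in F((1/t)): coefficient of t^j for
  -- every j ∈ ℤ, with only finitely many nonzero coefficients of positive
  -- powers of t (all coefficients above some exponent vanish).
  record LaurentSeries : Set where
    field
      coeff  : ℤ → Carrier
      top    : ℤ
      vanish : ∀ j → top < j → coeff j ≈ 0#
  open LaurentSeries public

  record NonZeroPoly : Set where
    field
      deg     : ℕ
      pcoeff  : Fin (suc deg) → Carrier
      leading : ¬ (pcoeff (fromℕ deg) ≈ 0#)
  open NonZeroPoly public

  sumFin : ∀ n → (Fin n → Carrier) → Carrier
  sumFin ℕ.zero    f = 0#
  sumFin (ℕ.suc n) f = f Fin.zero + sumFin n (λ i → f (Fin.suc i))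

  -- Coefficients (indexed by the exponent of t) of formal series.
  Series : Set
  Series = ℤ → Carrier

  polyMul : NonZeroPoly → Series → Series
  polyMul N θ j = sumFin (suc (deg N)) (λ k → pcoeff N k * θ (j ℤ.- + toℕ k))

  sub : Series → Series → Series
  sub x y j = x j + (CommutativeRing.-_ commRing (y j))

  frac : Series → Series
  frac x j with j ℤ.<? + 0
  ... | Relation.Nullary.yes _ = x j
  ... | Relation.Nullary.no  _ = 0#

  -- |x| ≥ q^k  (with |0| = 0): some coefficient of exponent ≥ k is nonzero
  AbsAtLeast : Series → ℤ → Set
  AbsAtLeast x k = ∃ λ j → k ≤ j × ¬ (x j ≈ 0#)

  -- c(θ,γ) ≥ q^{-2}, i.e. |N|·|⟨Nθ-γ⟩| ≥ q^{-2} for every N ≠ 0,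
  -- i.e. |⟨Nθ-γ⟩| ≥ q^{-2-deg N}.
  cAtLeastQ⁻² : LaurentSeries → LaurentSeries → Set
  cAtLeastQ⁻² θ γ =
    (N : NonZeroPoly) →
    AbsAtLeast (frac (sub (polyMul N (coeff θ)) (coeff γ))) (ℤ.- + 2 ℤ.- + deg N)

{-# OPTIONS --safe #-}
-- Write xₘ and gₘ for the coefficients of t^{-m} in θ and γ.  If A = [a₀, …, aₑ] satisfies
-- Σᵢ aᵢ x_{j+i} = 0 for j = 1, …, d+1, the same holds at j = 1 for the coefficients of Nθ in
-- place of x whenever deg N = d; so if also e ≤ d+1 and Σᵢ aᵢ g_{1+i} ≠ 0, one of the
-- coefficients of t^{-1}, …, t^{-(d+2)} in Nθ − γ is nonzero.  We therefore build g together
-- with, for every n, a monic such A of length at most n+1 for j = 1, …, n that pairs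
-- nontrivially with g.  From n to n+1 either A still works, or Gaussian elimination against
-- shifts of A and against the previous annihilator (as in Berlekamp–Massey) gives a monic one
-- of full length n+2, whose leading coefficient meets the still free value g_{n+2}.
module Submission where

open import Defs
open import Data.Nat using (ℕ; zero; suc; _∸_; z≤n; s≤s)
  renaming (_+_ to _+ℕ_; _≤_ to _≤ℕ_; _<_ to _<ℕ_)
import Data.Nat.Properties as ℕₚ
open import Data.Fin as Fin using (Fin; toℕ)
open import Data.Fin.Properties using (toℕ<n)
open import Data.Integer as ℤ using (ℤ; +_; -[1+_])
open import Data.List using (List; []; _∷_; _++_; length; map; replicate; [_])
import Data.List.Properties as Listₚ
open import Data.Maybe using (nothing)
open import Data.Product using (∃; _×_; _,_; proj₁; proj₂)
open import Data.Sum using (inj₁; inj₂)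
open import Data.Empty using (⊥-elim)
open import Relation.Nullary using (¬_; Dec; yes; no)
open import Relation.Binary.PropositionalEquality as ≡ using (_≡_)
open import Tactic.RingSolver.Core.AlmostCommutativeRing using (fromCommutativeRing)

module _ (F : FiniteField) where
  open FiniteField F
  open import Algebra.Properties.Ring ring
    using (-‿distribˡ-*; -‿distribʳ-*; -‿+-comm; -0#≈0#; x∙y⁻¹≈ε⇒x≈y)
  open import Tactic.RingSolver.NonReflective (fromCommutativeRing commRing (λ _ → nothing))
    using (solve; _⊜_; _⊕_; _⊗_)
  open import Algebra.Properties.CommutativeSemigroup +-commutativeSemigroup
    using () renaming (interchange to +-interchange)

  _≈?_ : (a b : Carrier) → Dec (a ≈ b)
  a ≈? b with enum-surjective a | enum-surjective b
  ... | i , eᵢ | j , eⱼ with i Fin.≟ j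
  ... | yes ≡.refl = yes (trans (sym eᵢ) eⱼ)
  ... | no i≢j = no (λ a≈b → i≢j (enum-injective i j (trans eᵢ (trans a≈b (sym eⱼ)))))

  _⁻¹ : Carrier → Carrier
  a ⁻¹ with a ≈? 0#
  ... | yes _ = 0#
  ... | no a≉0 = proj₁ (inverse a a≉0)

  *-inverseʳ : ∀ a → ¬ a ≈ 0# → a * a ⁻¹ ≈ 1#
  *-inverseʳ a a≉0 with a ≈? 0#
  ... | yes a≈0 = ⊥-elim (a≉0 a≈0)
  ... | no a≉0′ = proj₂ (inverse a a≉0′)

  avoidZero : Carrier → Carrier
  avoidZero v with v ≈? 0#
  ... | yes _ = 1#
  ... | no _ = 0#

  +-avoidZero : ∀ v → ¬ v + 1# * avoidZero v ≈ 0#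
  +-avoidZero v with v ≈? 0#
  ... | yes v≈0 = λ e → 0≉1 (sym (trans (sym (trans (+-cong v≈0 (*-identityˡ 1#)) (+-identityˡ 1#))) e))
  ... | no v≉0 = λ e → v≉0 (trans (sym (trans (+-congˡ (zeroʳ 1#)) (+-identityʳ v))) e)

  _+ᴸ_ : List Carrier → List Carrier → List Carrier
  [] +ᴸ bs = bs
  (a ∷ as) +ᴸ [] = a ∷ as
  (a ∷ as) +ᴸ (b ∷ bs) = a + b ∷ as +ᴸ bs

  length-+ᴸ : ∀ A B → length B ≤ℕ length A → length (A +ᴸ B) ≡ length A
  length-+ᴸ [] [] _ = ≡.refl
  length-+ᴸ (a ∷ as) [] _ = ≡.refl
  length-+ᴸ (a ∷ as) (b ∷ bs) (s≤s B≤A) = ≡.cong suc (length-+ᴸ as bs B≤A)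

  ∷ʳ-+ᴸ : ∀ A B c → length B ≤ℕ length A → (A ++ [ c ]) +ᴸ B ≡ (A +ᴸ B) ++ [ c ]
  ∷ʳ-+ᴸ [] [] c _ = ≡.refl
  ∷ʳ-+ᴸ (a ∷ as) [] c _ = ≡.refl
  ∷ʳ-+ᴸ (a ∷ as) (b ∷ bs) c (s≤s B≤A) = ≡.cong (a + b ∷_) (∷ʳ-+ᴸ as bs c B≤A)

  padLeft : ℕ → List Carrier → List Carrier
  padLeft n A = replicate n 0# ++ A

  length-padLeft : ∀ n A → length (padLeft n A) ≡ n +ℕ length A
  length-padLeft n A = ≡.trans (Listₚ.length-++ (replicate n 0#)) (≡.cong (_+ℕ length A) (Listₚ.length-replicate n))

  length-∷ʳ : ∀ (A : List Carrier) c → length (A ++ [ c ]) ≡ suc (length A)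
  length-∷ʳ A c = ≡.trans (Listₚ.length-++ A) (ℕₚ.+-comm (length A) 1)

  dotFrom : (ℕ → Carrier) → List Carrier → ℕ → Carrier
  dotFrom s [] k = 0#
  dotFrom s (a ∷ as) k = a * s k + dotFrom s as (suc k)

  dotFrom-+ᴸ : ∀ s A B k → dotFrom s (A +ᴸ B) k ≈ dotFrom s A k + dotFrom s B k
  dotFrom-+ᴸ s [] B k = sym (+-identityˡ _)
  dotFrom-+ᴸ s (a ∷ as) [] k = sym (+-identityʳ _)
  dotFrom-+ᴸ s (a ∷ as) (b ∷ bs) k =
    trans (+-congˡ (dotFrom-+ᴸ s as bs (suc k))) (interchange a b (s k) _ _)
    where
    interchange : ∀ a b z u v → (a + b) * z + (u + v) ≈ (a * z + u) + (b * z + v)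
    interchange = solve 5 (λ a b z u v → (a ⊕ b) ⊗ z ⊕ (u ⊕ v) ⊜ ((a ⊗ z ⊕ u) ⊕ (b ⊗ z ⊕ v))) refl

  dotFrom-scale : ∀ s c A k → dotFrom s (map (c *_) A) k ≈ c * dotFrom s A k
  dotFrom-scale s c [] k = sym (zeroʳ c)
  dotFrom-scale s c (a ∷ as) k =
    trans (+-cong (*-assoc c a (s k)) (dotFrom-scale s c as (suc k))) (sym (distribˡ c _ _))

  dotFrom-padLeft : ∀ s n A k → dotFrom s (padLeft n A) k ≈ dotFrom s A (n +ℕ k)
  dotFrom-padLeft s zero A k = refl
  dotFrom-padLeft s (suc n) A k = begin
    0# * s k + dotFrom s (padLeft n A) (suc k) ≈⟨ trans (+-congʳ (zeroˡ (s k))) (+-identityˡ _) ⟩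
    dotFrom s (padLeft n A) (suc k)            ≈⟨ dotFrom-padLeft s n A (suc k) ⟩
    dotFrom s A (n +ℕ suc k)                   ≡⟨ ≡.cong (dotFrom s A) (ℕₚ.+-suc n k) ⟩
    dotFrom s A (suc n +ℕ k)                   ∎
    where open import Relation.Binary.Reasoning.Setoid setoid

  dotFrom-∷ʳ : ∀ s A c k → dotFrom s (A ++ [ c ]) k ≈ dotFrom s A k + c * s (length A +ℕ k)
  dotFrom-∷ʳ s [] c k = trans (+-identityʳ _) (sym (+-identityˡ _))
  dotFrom-∷ʳ s (a ∷ as) c k =
    trans (+-congˡ (dotFrom-∷ʳ s as c (suc k)))
      (trans (sym (+-assoc _ _ _)) (+-congˡ (*-congˡ (reflexive (≡.cong s (ℕₚ.+-suc (length as) k))))))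

  dotFrom-cong : ∀ {s s′} A k → (∀ i → i <ℕ length A → s (i +ℕ k) ≈ s′ (i +ℕ k)) →
    dotFrom s A k ≈ dotFrom s′ A k
  dotFrom-cong [] k _ = refl
  dotFrom-cong {s} {s′} (a ∷ as) k s≈s′ =
    +-cong (*-congˡ (s≈s′ 0 (s≤s z≤n))) (dotFrom-cong as (suc k) λ i i< →
      ≡.subst (λ m → s m ≈ s′ m) (≡.sym (ℕₚ.+-suc i k)) (s≈s′ (suc i) (s≤s i<)))

  dotFrom-sub : ∀ s s′ A k → dotFrom (λ m → s m + - s′ m) A k ≈ dotFrom s A k + - dotFrom s′ A k
  dotFrom-sub s s′ [] k = sym (trans (+-congˡ -0#≈0#) (+-identityʳ 0#))
  dotFrom-sub s s′ (a ∷ as) k = begin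
    a * (s k + - s′ k) + dotFrom (λ m → s m + - s′ m) as (suc k)
      ≈⟨ +-cong (trans (distribˡ a _ _) (+-congˡ (sym (-‿distribʳ-* a (s′ k))))) (dotFrom-sub s s′ as (suc k)) ⟩
    (a * s k + - (a * s′ k)) + (dotFrom s as (suc k) + - dotFrom s′ as (suc k))
      ≈⟨ +-interchange _ _ _ _ ⟩
    (a * s k + dotFrom s as (suc k)) + (- (a * s′ k) + - dotFrom s′ as (suc k))
      ≈⟨ +-congˡ (-‿+-comm _ _) ⟩
    (a * s k + dotFrom s as (suc k)) + - (a * s′ k + dotFrom s′ as (suc k)) ∎
    where
    open import Relation.Binary.Reasoning.Setoid setoid

  dotFrom-nonzero : ∀ s A k → ¬ dotFrom s A k ≈ 0# → ∃ λ i → i <ℕ length A × ¬ s (i +ℕ k) ≈ 0#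
  dotFrom-nonzero s [] k nz = ⊥-elim (nz refl)
  dotFrom-nonzero s (a ∷ as) k nz with s k ≈? 0#
  ... | no sₖ≉0 = 0 , s≤s z≤n , sₖ≉0
  ... | yes sₖ≈0 with dotFrom-nonzero s as (suc k) (λ rest≈0 →
        nz (trans (+-cong (trans (*-congˡ sₖ≈0) (zeroʳ a)) rest≈0) (+-identityˡ 0#)))
  ...   | i , i< , sᵢ≉0 = suc i , s≤s i< , ≡.subst (λ m → ¬ s m ≈ 0#) (ℕₚ.+-suc i k) sᵢ≉0

  sumFin-cong : ∀ n {f g} → (∀ k → f k ≈ g k) → sumFin F n f ≈ sumFin F n g
  sumFin-cong zero f≈g = refl
  sumFin-cong (suc n) f≈g = +-cong (f≈g Fin.zero) (sumFin-cong n (λ k → f≈g (Fin.suc k)))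

  sumFin-+ : ∀ n f g → sumFin F n (λ k → f k + g k) ≈ sumFin F n f + sumFin F n g
  sumFin-+ zero f g = sym (+-identityˡ 0#)
  sumFin-+ (suc n) f g = trans (+-congˡ (sumFin-+ n _ _)) (+-interchange _ _ _ _)

  sumFin-*ˡ : ∀ n c f → sumFin F n (λ k → c * f k) ≈ c * sumFin F n f
  sumFin-*ˡ zero c f = sym (zeroʳ c)
  sumFin-*ˡ (suc n) c f = trans (+-congˡ (sumFin-*ˡ n c _)) (sym (distribˡ c _ _))

  sumFin-zero : ∀ n f → (∀ k → f k ≈ 0#) → sumFin F n f ≈ 0#
  sumFin-zero zero f f≈0 = refl
  sumFin-zero (suc n) f f≈0 =
    trans (+-cong (f≈0 Fin.zero) (sumFin-zero n _ (λ k → f≈0 (Fin.suc k)))) (+-identityˡ 0#)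

  -- The coefficient of t^{-m} in (Σₖ aₖ tᵏ)·(Σᵢ sᵢ t^{-i}).
  convolve : ∀ n → (Fin n → Carrier) → (ℕ → Carrier) → ℕ → Carrier
  convolve n a s m = sumFin F n (λ k → a k * s (m +ℕ toℕ k))

  dotFrom-convolve : ∀ n a s A j →
    dotFrom (convolve n a s) A j ≈ sumFin F n (λ k → a k * dotFrom s A (j +ℕ toℕ k))
  dotFrom-convolve n a s [] j = sym (sumFin-zero n _ (λ k → zeroʳ (a k)))
  dotFrom-convolve n a s (c ∷ cs) j =
    trans (+-cong (sym (sumFin-*ˡ n c _)) (dotFrom-convolve n a s cs (suc j)))
      (trans (sym (sumFin-+ n _ _)) (sumFin-cong n (λ k → commute c (a k) _ _)))
    where
    commute : ∀ c a z u → c * (a * z) + a * u ≈ a * (c * z + u)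
    commute = solve 4 (λ c a z u → c ⊗ (a ⊗ z) ⊕ a ⊗ u ⊜ (a ⊗ (c ⊗ z ⊕ u))) refl

  dotFrom-convolve-annihilated : ∀ n a s A j → (∀ k → k <ℕ n → dotFrom s A (j +ℕ k) ≈ 0#) →
    dotFrom (convolve n a s) A j ≈ 0#
  dotFrom-convolve-annihilated n a s A j ann = trans (dotFrom-convolve n a s A j)
    (sumFin-zero n (λ k → a k * dotFrom s A (j +ℕ toℕ k))
      (λ k → trans (*-congˡ (ann (toℕ k) (toℕ<n k))) (zeroʳ (a k))))

  module Annihilators (x : ℕ → Carrier) where

    discrepancy : ℕ → List Carrier → Carrier
    discrepancy j A = dotFrom x A j

    -- Window 0 is never used: the sequence of interest starts at x₁.
    AnnihilatesBelow : List Carrier → ℕ → Set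
    AnnihilatesBelow A p = ∀ j → 0 <ℕ j → j <ℕ p → discrepancy j A ≈ 0#

    monic : List Carrier → List Carrier
    monic L = L ++ [ 1# ]

    padLeft-annihilatesBelow : ∀ n A p → AnnihilatesBelow A (n +ℕ p) → AnnihilatesBelow (padLeft n A) p
    padLeft-annihilatesBelow n A p ann j 0<j j<p =
      trans (dotFrom-padLeft x n A j)
        (ann (n +ℕ j) (ℕₚ.<-≤-trans 0<j (ℕₚ.m≤n+m j n)) (ℕₚ.+-monoʳ-< n j<p))

    eliminate : ℕ → List Carrier → List Carrier → List Carrier
    eliminate p L K = L +ᴸ map (- (discrepancy p (monic L) * discrepancy p K ⁻¹) *_) K

    module _ (p : ℕ) (L K : List Carrier) (K≤L : length K ≤ℕ length L) where
      private
        α = discrepancy p (monic L) * discrepancy p K ⁻¹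
        K′≤L : length (map (- α *_) K) ≤ℕ length L
        K′≤L = ≡.subst (_≤ℕ length L) (≡.sym (Listₚ.length-map _ K)) K≤L

      length-eliminate : length (eliminate p L K) ≡ length L
      length-eliminate = length-+ᴸ L _ K′≤L

      discrepancy-eliminate : ∀ j →
        discrepancy j (monic (eliminate p L K)) ≈ discrepancy j (monic L) + - α * discrepancy j K
      discrepancy-eliminate j =
        trans (reflexive (≡.cong (discrepancy j) (≡.sym (∷ʳ-+ᴸ L _ 1# K′≤L))))
          (trans (dotFrom-+ᴸ x (monic L) _ j) (+-congˡ (dotFrom-scale x (- α) K j)))

      eliminate-annihilatesBelow : AnnihilatesBelow (monic L) p → AnnihilatesBelow K p →
        ¬ discrepancy p K ≈ 0# → AnnihilatesBelow (monic (eliminate p L K)) (suc p)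
      eliminate-annihilatesBelow annL annK dₖ≉0 j 0<j j≤p
        with ℕₚ.m≤n⇒m<n∨m≡n (ℕₚ.≤-pred j≤p)
      ... | inj₁ j<p = trans (discrepancy-eliminate j)
              (trans (+-cong (annL j 0<j j<p) (trans (*-congˡ (annK j 0<j j<p)) (zeroʳ _))) (+-identityˡ 0#))
      ... | inj₂ ≡.refl = trans (discrepancy-eliminate j) (cancel (discrepancy j (monic L)) (discrepancy j K) dₖ≉0)
        where
        cancel : ∀ d e → ¬ e ≈ 0# → d + - (d * e ⁻¹) * e ≈ 0#
        cancel d e e≉0 = begin
          d + - (d * e ⁻¹) * e  ≈⟨ +-congˡ (sym (-‿distribˡ-* _ e)) ⟩
          d + - (d * e ⁻¹ * e)  ≈⟨ +-congˡ (-‿cong (trans (*-assoc d _ e) (*-congˡ (trans (*-comm _ e) (*-inverseʳ e e≉0))))) ⟩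
          d + - (d * 1#)        ≈⟨ +-congˡ (-‿cong (*-identityʳ d)) ⟩
          d + - d               ≈⟨ -‿inverseʳ d ⟩
          0#                    ∎
          where open import Relation.Binary.Reasoning.Setoid setoid

    -- Clears windows p, …, p+n−1: at window p the pivot padLeft (D ∸ p) M has the discrepancy
    -- of M at window D.
    eliminateFrom : List Carrier → ℕ → ℕ → ℕ → List Carrier → List Carrier
    eliminateFrom M D p zero L = L
    eliminateFrom M D p (suc n) L = eliminateFrom M D (suc p) n (eliminate p L (padLeft (D ∸ p) M))

    module _ (M : List Carrier) (D : ℕ) (annM : AnnihilatesBelow M D) (dₘ≉0 : ¬ discrepancy D M ≈ 0#) where

      eliminateFrom-correct : ∀ n p L → p +ℕ n ≡ suc D → length M ≤ℕ p → length L ≡ D →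
        AnnihilatesBelow (monic L) p →
        length (eliminateFrom M D p n L) ≡ D × AnnihilatesBelow (monic (eliminateFrom M D p n L)) (suc D)
      eliminateFrom-correct zero p L p≡1+D _ L≡D annL =
        L≡D , ≡.subst (AnnihilatesBelow (monic L)) (≡.trans (≡.sym (ℕₚ.+-identityʳ p)) p≡1+D) annL
      eliminateFrom-correct (suc n) p L p+1+n≡1+D M≤p L≡D annL =
        eliminateFrom-correct n (suc p) _ (≡.trans (≡.sym (ℕₚ.+-suc p n)) p+1+n≡1+D) (ℕₚ.m≤n⇒m≤1+n M≤p)
          (≡.trans (length-eliminate p L K K≤L) L≡D)
          (eliminate-annihilatesBelow p L K K≤L annL annK dₖ≉0)
        where
        p≤D : p ≤ℕ D
        p≤D = ℕₚ.≤-pred (≡.subst (suc p ≤ℕ_) p+1+n≡1+D (ℕₚ.m<m+n p (s≤s z≤n)))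
        D∸p+p≡D : D ∸ p +ℕ p ≡ D
        D∸p+p≡D = ℕₚ.m∸n+n≡m p≤D
        K = padLeft (D ∸ p) M
        K≤L : length K ≤ℕ length L
        K≤L = ≡.subst₂ _≤ℕ_ (≡.sym (length-padLeft (D ∸ p) M)) (≡.trans D∸p+p≡D (≡.sym L≡D))
                (ℕₚ.+-monoʳ-≤ (D ∸ p) M≤p)
        annK : AnnihilatesBelow K p
        annK = padLeft-annihilatesBelow (D ∸ p) M p (≡.subst (AnnihilatesBelow M) (≡.sym D∸p+p≡D) annM)
        dₖ≉0 : ¬ discrepancy p K ≈ 0#
        dₖ≉0 dₖ≈0 = dₘ≉0 (trans (reflexive (≡.cong (λ m → discrepancy m M) (≡.sym D∸p+p≡D)))
                           (trans (sym (dotFrom-padLeft x (D ∸ p) M p)) dₖ≈0))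

    PivotAt : List Carrier → ℕ → Set
    PivotAt B e = 0 <ℕ e → length B ≤ℕ e × AnnihilatesBelow B e × ¬ discrepancy e B ≈ 0#

    usePivot : ℕ → List Carrier → List Carrier → List Carrier
    usePivot zero B L = L
    usePivot (suc e) B L = eliminate (suc e) L B

    usePivot-correct : ∀ e B L → PivotAt B e → e ≤ℕ length L → AnnihilatesBelow (monic L) e →
      length (usePivot e B L) ≡ length L × AnnihilatesBelow (monic (usePivot e B L)) (suc e)
    usePivot-correct zero B L _ _ _ = ≡.refl , λ { (suc j) _ (s≤s ()) }
    usePivot-correct (suc e) B L pivot e≤L annL with pivot (s≤s z≤n)
    ... | B≤e , annB , d≉0 =
      length-eliminate (suc e) L B B≤L , eliminate-annihilatesBelow (suc e) L B B≤L annL annB d≉0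
      where
      B≤L = ℕₚ.≤-trans B≤e e≤L

    -- The new annihilator when monic low fails at window D: shift it up to full length,
    -- clear window length low with the pivot and the windows above it with shifts of monic low.
    jump : List Carrier → List Carrier → ℕ → List Carrier
    jump low B D = eliminateFrom (monic low) D (suc (length low)) (D ∸ length low)
                     (usePivot (length low) B (padLeft (D ∸ length low) low))

    jump-correct : ∀ low B D → length low <ℕ D → AnnihilatesBelow (monic low) D →
      ¬ discrepancy D (monic low) ≈ 0# → PivotAt B (length low) →
      length (jump low B D) ≡ D × AnnihilatesBelow (monic (jump low B D)) (suc D)
    jump-correct low B D e<D annM d≉0 pivot =
      eliminateFrom-correct (monic low) D annM d≉0 (D ∸ e) (suc e) _
        (≡.cong suc (ℕₚ.m+[n∸m]≡n e≤D)) (ℕₚ.≤-reflexive (length-∷ʳ low 1#))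
        (≡.trans (proj₁ started) L₀≡D) (proj₂ started)
      where
      e = length low
      e≤D = ℕₚ.<⇒≤ e<D
      L₀ = padLeft (D ∸ e) low
      L₀≡D : length L₀ ≡ D
      L₀≡D = ≡.trans (length-padLeft (D ∸ e) low) (ℕₚ.m∸n+n≡m e≤D)
      annL₀ : AnnihilatesBelow (monic L₀) e
      annL₀ = ≡.subst (λ A → AnnihilatesBelow A e) (≡.sym (Listₚ.++-assoc (replicate (D ∸ e) 0#) low [ 1# ]))
        (padLeft-annihilatesBelow (D ∸ e) (monic low) e
          (≡.subst (AnnihilatesBelow (monic low)) (≡.sym (ℕₚ.m∸n+n≡m e≤D)) annM))
      started = usePivot-correct e B L₀ pivot (≡.subst (e ≤ℕ_) (≡.sym L₀≡D) e≤D) annL₀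

    -- A prefix [g₁, …, gₖ] read as a sequence, with g₀ = 0 and zeros beyond the prefix.
    fromPrefix : List Carrier → ℕ → Carrier
    fromPrefix g zero = 0#
    fromPrefix [] (suc i) = 0#
    fromPrefix (a ∷ as) (suc zero) = a
    fromPrefix (a ∷ as) (suc (suc i)) = fromPrefix as (suc i)

    fromPrefix-++ : ∀ A B m → m ≤ℕ length A → fromPrefix (A ++ B) m ≡ fromPrefix A m
    fromPrefix-++ A B zero _ = ≡.refl
    fromPrefix-++ (a ∷ as) B (suc zero) _ = ≡.refl
    fromPrefix-++ (a ∷ as) B (suc (suc i)) (s≤s i<) = fromPrefix-++ as B (suc i) i<

    fromPrefix-∷ʳ : ∀ A v → fromPrefix (A ++ [ v ]) (suc (length A)) ≡ v
    fromPrefix-∷ʳ [] v = ≡.refl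
    fromPrefix-∷ʳ (a ∷ as) v = fromPrefix-∷ʳ as v

    dotFrom-fromPrefix-++ : ∀ g B W → length W ≤ℕ length g →
      dotFrom (fromPrefix (g ++ B)) W 1 ≈ dotFrom (fromPrefix g) W 1
    dotFrom-fromPrefix-++ g B W W≤g = dotFrom-cong W 1 (λ i i<W →
      reflexive (fromPrefix-++ g B (i +ℕ 1) (≡.subst (_≤ℕ length g) (ℕₚ.+-comm 1 i) (ℕₚ.≤-trans i<W W≤g))))

    record State : Set where
      constructor state
      field
        low    : List Carrier
        pivot  : List Carrier
        prefix : List Carrier
    open State

    step : ℕ → State → State
    step n (state L B g) with discrepancy (suc n) (monic L) ≈? 0#
    ... | yes _ = state L B (g ++ [ 0# ])
    ... | no _ = state L′ (monic L) (g ++ [ avoidZero (dotFrom (fromPrefix g) L′ 1) ])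
      where L′ = jump L B (suc n)

    stage : ℕ → State
    stage zero = state [] [] [ 1# ]
    stage (suc n) = step n (stage n)

    record Invariant (n : ℕ) (S : State) : Set where
      field
        low-length    : length (low S) ≤ℕ n
        annihilates   : AnnihilatesBelow (monic (low S)) (suc n)
        pivot-at      : PivotAt (pivot S) (length (low S))
        prefix-length : length (prefix S) ≡ suc n
        pairs-nonzero : ¬ dotFrom (fromPrefix (prefix S)) (monic (low S)) 1 ≈ 0#

    invariant-stage₀ : Invariant 0 (stage 0)
    invariant-stage₀ = record
      { low-length    = z≤n
      ; annihilates   = λ { (suc j) _ (s≤s ()) }
      ; pivot-at      = λ ()
      ; prefix-length = ≡.refl
      ; pairs-nonzero = λ e → 0≉1 (sym (trans (sym (trans (+-identityʳ _) (*-identityʳ 1#))) e))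
      }

    invariant-step : ∀ n S → Invariant n S → Invariant (suc n) (step n S)
    invariant-step n (state L B g) I with discrepancy (suc n) (monic L) ≈? 0#
    ... | yes d≈0 = record
      { low-length    = ℕₚ.m≤n⇒m≤1+n low-length
      ; annihilates   = annihilates′
      ; pivot-at      = pivot-at
      ; prefix-length = ≡.trans (length-∷ʳ g 0#) (≡.cong suc prefix-length)
      ; pairs-nonzero = λ e → pairs-nonzero (trans (sym (dotFrom-fromPrefix-++ g [ 0# ] (monic L) M≤g)) e)
      }
      where
      open Invariant I
      M≤g : length (monic L) ≤ℕ length g
      M≤g = ≡.subst₂ _≤ℕ_ (≡.sym (length-∷ʳ L 1#)) (≡.sym prefix-length) (s≤s low-length)
      annihilates′ : AnnihilatesBelow (monic L) (suc (suc n))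
      annihilates′ j 0<j j≤1+n with ℕₚ.m≤n⇒m<n∨m≡n (ℕₚ.≤-pred j≤1+n)
      ... | inj₁ j≤n = annihilates j 0<j j≤n
      ... | inj₂ ≡.refl = d≈0
    ... | no d≉0 = record
      { low-length    = ℕₚ.≤-reflexive L′≡1+n
      ; annihilates   = annL′
      ; pivot-at      = λ _ → ≡.subst (length (monic L) ≤ℕ_) (≡.sym L′≡1+n) M≤1+n
                            , ≡.subst (AnnihilatesBelow (monic L)) (≡.sym L′≡1+n) annihilates
                            , ≡.subst (λ m → ¬ discrepancy m (monic L) ≈ 0#) (≡.sym L′≡1+n) d≉0
      ; prefix-length = ≡.trans (length-∷ʳ g _) (≡.cong suc prefix-length)
      ; pairs-nonzero = pairs-nonzero′
      }
      where
      open Invariant I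
      M≤1+n : length (monic L) ≤ℕ suc n
      M≤1+n = ≡.subst (_≤ℕ suc n) (≡.sym (length-∷ʳ L 1#)) (s≤s low-length)
      L′ = jump L B (suc n)
      jumped = jump-correct L B (suc n) (s≤s low-length) annihilates d≉0 pivot-at
      L′≡1+n : length L′ ≡ suc n
      L′≡1+n = proj₁ jumped
      annL′ = proj₂ jumped
      L′≡g : length L′ ≡ length g
      L′≡g = ≡.trans L′≡1+n (≡.sym prefix-length)
      v = avoidZero (dotFrom (fromPrefix g) L′ 1)
      g′ = fromPrefix (g ++ [ v ])
      -- The leading 1 of monic L′ meets the freshly chosen value v.
      pairs-nonzero′ : ¬ dotFrom g′ (monic L′) 1 ≈ 0#
      pairs-nonzero′ e = +-avoidZero (dotFrom (fromPrefix g) L′ 1) (begin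
        dotFrom (fromPrefix g) L′ 1 + 1# * v
          ≈⟨ +-cong (sym (dotFrom-fromPrefix-++ g [ v ] L′ (ℕₚ.≤-reflexive L′≡g)))
                    (*-congˡ (reflexive (≡.sym (≡.trans (≡.cong g′ (≡.trans (ℕₚ.+-comm (length L′) 1) (≡.cong suc L′≡g)))
                                                          (fromPrefix-∷ʳ g v))))) ⟩
        dotFrom g′ L′ 1 + 1# * g′ (length L′ +ℕ 1)
          ≈⟨ sym (dotFrom-∷ʳ g′ L′ 1# 1) ⟩
        dotFrom g′ (monic L′) 1
          ≈⟨ e ⟩
        0# ∎)
        where open import Relation.Binary.Reasoning.Setoid setoid

    invariant : ∀ n → Invariant n (stage n)
    invariant zero = invariant-stage₀
    invariant (suc n) = invariant-step n (stage n) (invariant n)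

    prefix-step : ∀ n S → ∃ λ v → prefix (step n S) ≡ prefix S ++ [ v ]
    prefix-step n (state L B g) with discrepancy (suc n) (monic L) ≈? 0#
    ... | yes _ = _ , ≡.refl
    ... | no _ = _ , ≡.refl

    prefix-stable : ∀ k n m → m ≤ℕ suc n →
      fromPrefix (prefix (stage (k +ℕ n))) m ≡ fromPrefix (prefix (stage n)) m
    prefix-stable zero n m _ = ≡.refl
    prefix-stable (suc k) n m m≤1+n with prefix-step (k +ℕ n) (stage (k +ℕ n))
    ... | v , extends = ≡.trans (≡.cong (λ g → fromPrefix g m) extends)
      (≡.trans (fromPrefix-++ _ [ v ] m (ℕₚ.≤-trans m≤1+n 1+n≤prefix)) (prefix-stable k n m m≤1+n))
      where
      1+n≤prefix : suc n ≤ℕ length (prefix (stage (k +ℕ n)))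
      1+n≤prefix = ≡.subst (suc n ≤ℕ_) (≡.sym (Invariant.prefix-length (invariant (k +ℕ n))))
                     (s≤s (ℕₚ.m≤n+m n k))

    g : ℕ → Carrier
    g zero = 0#
    g (suc i) = fromPrefix (prefix (stage i)) (suc i)

    g-prefix : ∀ n m → m ≤ℕ suc n → g m ≡ fromPrefix (prefix (stage n)) m
    g-prefix n zero _ = ≡.refl
    g-prefix n (suc i) (s≤s i≤n) =
      ≡.sym (≡.subst (λ k → fromPrefix (prefix (stage k)) (suc i) ≡ g (suc i))
                     (ℕₚ.m∸n+n≡m i≤n) (prefix-stable (n ∸ i) i (suc i) ℕₚ.≤-refl))

    annihilator : ∀ n → ∃ λ A → length A ≤ℕ suc n × AnnihilatesBelow A (suc n) × ¬ dotFrom g A 1 ≈ 0#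
    annihilator n = monic (low S) , M≤1+n , annihilates , λ e → pairs-nonzero (trans (sym agree) e)
      where
      S = stage n
      open Invariant (invariant n)
      M≤1+n : length (monic (low S)) ≤ℕ suc n
      M≤1+n = ≡.subst (_≤ℕ suc n) (≡.sym (length-∷ʳ (low S) 1#)) (s≤s low-length)
      agree : dotFrom g (monic (low S)) 1 ≈ dotFrom (fromPrefix (prefix S)) (monic (low S)) 1
      agree = dotFrom-cong (monic (low S)) 1 (λ i i<M →
        reflexive (g-prefix n (i +ℕ 1) (≡.subst (_≤ℕ suc n) (ℕₚ.+-comm 1 i) (ℕₚ.≤-trans i<M M≤1+n))))

    annihilator-separates : ∀ d (a : Fin (suc d) → Carrier) →
      ∃ λ i → i ≤ℕ suc d × ¬ convolve (suc d) a x (suc i) + - g (suc i) ≈ 0#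
    annihilator-separates d a with annihilator (suc d)
    ... | A , A≤2+d , annA , gA≉0 =
      let i , i<A , nz = dotFrom-nonzero difference A 1 differs
      in i , ℕₚ.≤-pred (ℕₚ.≤-trans i<A A≤2+d) , ≡.subst (λ m → ¬ difference m ≈ 0#) (ℕₚ.+-comm i 1) nz
      where
      difference : ℕ → Carrier
      difference m = convolve (suc d) a x m + - g m
      killsConvolution : dotFrom (convolve (suc d) a x) A 1 ≈ 0#
      killsConvolution = dotFrom-convolve-annihilated (suc d) a x A 1
        (λ k k≤d → annA (suc k) (s≤s z≤n) (s≤s k≤d))
      differs : ¬ dotFrom difference A 1 ≈ 0#
      differs e = gA≉0 (sym (trans (sym killsConvolution)
        (x∙y⁻¹≈ε⇒x≈y _ _ (trans (sym (dotFrom-sub (convolve (suc d) a x) g A 1)) e))))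

  fractionalPart : LaurentSeries F → ℕ → Carrier
  fractionalPart θ zero = 0#
  fractionalPart θ (suc m) = coeff θ -[1+ m ]

  seriesFromFractional : (ℕ → Carrier) → LaurentSeries F
  seriesFromFractional s = record { coeff = c ; top = + 0 ; vanish = λ { (+ n) _ → refl ; -[1+ m ] () } }
    where
    c : ℤ → Carrier
    c (+ _) = 0#
    c -[1+ m ] = s (suc m)

  -[1+]-minus : ∀ i k → -[1+ i ] ℤ.- + k ≡ -[1+ i +ℕ k ]
  -[1+]-minus i zero = ≡.cong -[1+_] (≡.sym (ℕₚ.+-identityʳ i))
  -[1+]-minus i (suc k) = ≡.cong -[1+_] (≡.sym (ℕₚ.+-suc i k))

  frac-negative : ∀ (X : ℤ → Carrier) i → frac F X -[1+ i ] ≡ X -[1+ i ]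
  frac-negative X i with -[1+ i ] ℤ.<? + 0
  ... | yes _ = ≡.refl
  ... | no ≮0 = ⊥-elim (≮0 ℤ.-<+)

  frac-coeff : ∀ θ s N i →
    frac F (sub F (polyMul F N (coeff θ)) (coeff (seriesFromFractional s))) -[1+ i ]
      ≈ convolve (suc (deg N)) (pcoeff N) (fractionalPart θ) (suc i) + - s (suc i)
  frac-coeff θ s N i = trans (reflexive (frac-negative (sub F (polyMul F N (coeff θ)) (coeff (seriesFromFractional s))) i))
    (+-congʳ (sumFin-cong (suc (deg N)) (λ k → *-congˡ {pcoeff N k} (reflexive (≡.cong (coeff θ) (-[1+]-minus i (toℕ k)))))))

-2-d≡-[1+1+d] : ∀ d → ℤ.- (+ 2) ℤ.- (+ d) ≡ -[1+ suc d ]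
-2-d≡-[1+1+d] zero = ≡.refl
-2-d≡-[1+1+d] (suc d) = ≡.refl

proposition3p6 : (F : FiniteField) → (θ : LaurentSeries F) →
    ∃ λ (γ : LaurentSeries F) → cAtLeastQ⁻² F θ γ
proposition3p6 F θ = seriesFromFractional F g , bound
  where
  open FiniteField F using (_≈_; 0#; trans; sym)
  open Annihilators F (fractionalPart F θ)
  bound : cAtLeastQ⁻² F θ (seriesFromFractional F g)
  bound N with annihilator-separates (deg N) (pcoeff N)
  ... | i , i≤1+d , nz = -[1+ i ]
    , ≡.subst (ℤ._≤ -[1+ i ]) (≡.sym (-2-d≡-[1+1+d] (deg N))) (ℤ.-≤- i≤1+d)
    , λ e → nz (trans (sym (frac-coeff F θ g N i)) e)
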